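{- Let $T$ be a trigonal graph with $|V(T)|=t$, and let $u,v$ be two distinct vertices of $T$ with $\mathrm{dist}_{\partial T}(u,v)=d$. Then for every integer $\ell\in[d,t-d]$, $T$ contains a $(u,v)$-path of length $\ell$. In particular, if $uv\in E(\partial T)$, then $T$ contains $(u,v)$-paths of every length in $[1,t-1]$.
   Context: A trigonal graph is a graph $T$ together with a Hamiltonian cycle $\partial T$ (its boundary cycle), obtained as the last term $T_n$ of a sequence $T_3,\dots,T_n$ where $T_3\cong K_3$ with $\partial T_3=T_3$, and for $3\le i\le n-1$, $T_{i+1}$ is obtained from $T_i$ by adding a new vertex $x_i$ and the path $a_ix_ib_i$ for some edge $a_ib_i\in E(\partial T_i)$, with $\partial T_{i+1}$ obtained from $\partial T_i$ by adding the path $a_ix_ib_i$ and deleting the edge $a_ib_i$; $\partial T=\partial T_n$. $\mathrm{dist}_{\partial T}(u,v)$ is the distance between $u$ and $v$ along the cycle $\partial T$. -}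

module Defs where

open import Data.Nat using (ℕ; suc; _≤_; _∸_; ∣_-_∣; _⊓_)
open import Data.Fin using (Fin; toℕ)
open import Data.List using (List; []; _∷_; _++_; [_]; length; lookup)
open import Data.List.Membership.Propositional using (_∈_)
open import Data.List.Relation.Unary.Unique.Propositional using (Unique)
open import Data.Product using (_×_; _,_; Σ; ∃)
open import Data.Sum using (_⊎_)
open import Relation.Binary.PropositionalEquality using (_≡_)

-- A graph on vertex set {0,…,n-1} is given by a list of (undirected) edges.
Edges : Set
Edges = List (ℕ × ℕ)

Adj : Edges → ℕ → ℕ → Set
Adj E x y = ((x , y) ∈ E) ⊎ ((y , x) ∈ E)

-- Trigonal n E B : the graph with vertices 0..n-1 and edge list E is trigonal
-- with boundary cycle B (listed in cyclic order c₀ c₁ … c_{n-1}; the cycle edges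
-- are c_i c_{i+1} and c_{n-1} c₀).
data Trigonal : ℕ → Edges → List ℕ → Set where
  base : Trigonal 3 ((0 , 1) ∷ (1 , 2) ∷ (2 , 0) ∷ []) (0 ∷ 1 ∷ 2 ∷ [])
  stepIn : ∀ {n E} (P Q : List ℕ) (a b : ℕ) →
    Trigonal n E (P ++ a ∷ b ∷ Q) →
    Trigonal (suc n) ((a , n) ∷ (n , b) ∷ E) (P ++ a ∷ n ∷ b ∷ Q)
  stepWrap : ∀ {n E} (P : List ℕ) (a b : ℕ) →
    Trigonal n E (a ∷ P ++ [ b ]) →
    Trigonal (suc n) ((b , n) ∷ (n , a) ∷ E) (a ∷ P ++ b ∷ n ∷ [])

data Walk (E : Edges) : ℕ → ℕ → List ℕ → Set where
  single : ∀ u → Walk E u u (u ∷ [])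
  cons : ∀ {u w v vs} → Adj E u w → Walk E w v vs → Walk E u v (u ∷ vs)

Path : Edges → ℕ → ℕ → ℕ → Set
Path E u v ℓ = Σ (List ℕ) λ vs → Walk E u v vs × Unique vs × length vs ≡ suc ℓ

cycDist : (B : List ℕ) → Fin (length B) → Fin (length B) → ℕ
cycDist B i j = ∣ toℕ i - toℕ j ∣ ⊓ (length B ∸ ∣ toℕ i - toℕ j ∣)

BoundaryEdge : List ℕ → ℕ → ℕ → Set
BoundaryEdge B u v =
  (∃ λ P → ∃ λ Q → B ≡ P ++ u ∷ v ∷ Q) ⊎ (∃ λ P → ∃ λ Q → B ≡ P ++ v ∷ u ∷ Q) ⊎
  (∃ λ P → B ≡ u ∷ P ++ [ v ]) ⊎ (∃ λ P → B ≡ v ∷ P ++ [ u ])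

-- Induction along the construction proves a stronger invariant: for any two boundary
-- vertices x and v, whose two boundary arcs have a and b edges, there are (x,v)-paths
-- of every length between a and b.  When n is inserted into the boundary edge ps, two
-- old vertices keep their old paths, and the only new length, that of the arc through
-- n, is realised by this boundary arc itself.  A path from n starts with the edge ns
-- or np and continues with an old path; the two ranges of lengths obtained in this
-- way overlap and together cover the required interval.
module Submission where

open import Defs
open import Data.Empty using (⊥-elim)
open import Data.Fin using (Fin; toℕ; zero; suc)
open import Data.Fin.Properties using (toℕ-injective)
open import Data.List using (List; []; _∷_; _++_; [_]; length; lookup; reverse; downFrom; initLast; _∷ʳ′_)
open import Data.List.Properties
  using ( ++-assoc; ++-identityʳ; length-++; ∷-injective; ∷ʳ-injective
        ; unfold-reverse; length-reverse; length-downFrom)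
open import Data.List.Membership.Propositional.Properties using (∈-downFrom⁻)
open import Data.List.Relation.Binary.Permutation.Propositional using (_↭_; ↭-refl; prep; swap; ↭-sym; ↭-trans; ↭⇒↭ₛ)
open import Data.List.Relation.Binary.Permutation.Propositional.Properties using (++-comm; ↭-length; ∈-resp-↭; ↭-reverse)
open import Data.List.Relation.Binary.Subset.Propositional using (_⊆_)
open import Data.List.Relation.Unary.All as All using (All; []; _∷_)
import Data.List.Relation.Unary.All.Properties as All
open import Data.List.Relation.Unary.Any using (here; there)
open import Data.List.Relation.Unary.Unique.Propositional using (Unique; []; _∷_)
open import Data.List.Relation.Unary.Unique.Propositional.Properties using (downFrom⁺)
open import Data.Nat using (ℕ; suc; _≤_; _<_; _+_; _∸_; _⊓_; ∣_-_∣; z≤n; s≤s; z<s; s<s)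
open import Data.Nat.Properties
  using (≤-antisym; ≤-total; <⇒≤; >⇒≢; m≤n⇒m≤1+n; m<n⇒m<1+n; n<1+n; m≤n⇒m<n∨m≡n
        ; m≤n⇒m⊓n≡m; m≥n⇒m⊓n≡n; m+n∸m≡n; m+n∸n≡m; +-suc; +-comm; ∣-∣-comm; ∣m-m+n∣≡n; <-cmp)
open import Data.Product using (_×_; _,_; ∃; ∃₂; proj₁; proj₂)
import Data.Product as Product
open import Data.Sum using (_⊎_; inj₁; inj₂)
import Data.Sum as Sum
open import Relation.Binary.Definitions using (tri<; tri≈; tri>)
open import Relation.Unary using (_⟨×⟩_)
open import Relation.Binary.PropositionalEquality
  using (_≡_; _≢_; refl; sym; trans; cong; subst; setoid; module ≡-Reasoning)
open import Data.List.Relation.Binary.Permutation.Setoid.Properties (setoid ℕ)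
  using () renaming (Unique-resp-↭ to Unique-resp-↭ₛ)

-- Rotations of lists

module _ {a} {A : Set a} where

  Rotation : List A → List A → Set a
  Rotation xs ys = ∃₂ λ X Y → xs ≡ X ++ Y × ys ≡ Y ++ X

  rotation-refl : ∀ xs → Rotation xs xs
  rotation-refl xs = [] , xs , refl , sym (++-identityʳ xs)

  rotation-reflexive : ∀ {xs ys} → xs ≡ ys → Rotation xs ys
  rotation-reflexive refl = rotation-refl _

  rotation-swap : ∀ X Y → Rotation (X ++ Y) (Y ++ X)
  rotation-swap X Y = X , Y , refl , refl

  rotation⇒↭ : ∀ {xs ys} → Rotation xs ys → xs ↭ ys
  rotation⇒↭ (X , Y , refl , refl) = ++-comm X Y

  ++-overlap : ∀ (xs ys zs ws : List A) → xs ++ ys ≡ zs ++ ws →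
    (∃ λ Z → zs ≡ xs ++ Z × ys ≡ Z ++ ws) ⊎ (∃₂ λ z Z → xs ≡ zs ++ z ∷ Z × ws ≡ z ∷ Z ++ ys)
  ++-overlap []       ys zs       ws eq = inj₁ (zs , refl , eq)
  ++-overlap (x ∷ xs) ys []       ws eq = inj₂ (x , xs , refl , sym eq)
  ++-overlap (x ∷ xs) ys (z ∷ zs) ws eq with refl , eq′ ← ∷-injective eq with ++-overlap xs ys zs ws eq′
  ... | inj₁ (Z , refl , refl)     = inj₁ (Z , refl , refl)
  ... | inj₂ (y , Z , refl , refl) = inj₂ (y , Z , refl , refl)

  rotation-trans : ∀ {xs ys zs} → Rotation xs ys → Rotation ys zs → Rotation xs zs
  rotation-trans (X₁ , Y₁ , refl , refl) (X₂ , Y₂ , eq , refl) with ++-overlap Y₁ X₁ X₂ Y₂ eq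
  ... | inj₁ (Z , refl , refl)     = Z , Y₂ ++ Y₁ , ++-assoc Z Y₂ Y₁ , sym (++-assoc Y₂ Y₁ Z)
  ... | inj₂ (y , Z , refl , refl) = X₁ ++ X₂ , y ∷ Z , sym (++-assoc X₁ X₂ (y ∷ Z)) , ++-assoc (y ∷ Z) X₁ X₂

  rotation-∷ : ∀ {n C R} → Rotation (n ∷ C) R → ∃₂ λ X Y → C ≡ X ++ Y × R ≡ Y ++ n ∷ X
  rotation-∷ {C = C} ([] , _ , refl , refl) = C , [] , sym (++-identityʳ C) , ++-identityʳ _
  rotation-∷ (_ ∷ X , Y , eq , refl) with refl , eq′ ← ∷-injective eq = X , Y , eq′ , refl

  -- C reads the cycle from the vertex after n.
  rotation-∷-split : ∀ {n C} X Y → Rotation (n ∷ C) (X ++ Y) →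
    (∃₂ λ P Q → X ≡ P ++ n ∷ Q × C ≡ Q ++ Y ++ P) ⊎ (∃₂ λ P Q → Y ≡ P ++ n ∷ Q × C ≡ Q ++ X ++ P)
  rotation-∷-split {n} X Y r with X′ , Y′ , refl , eq ← rotation-∷ r with ++-overlap X Y Y′ (n ∷ X′) eq
  ... | inj₁ (Z , refl , refl)     = inj₂ (Z , X′ , refl , refl)
  ... | inj₂ (_ , Z , refl , refl) = inj₁ (Y′ , Z , refl , ++-assoc Z Y Y′)

  ∷-∷ʳ-split : ∀ {s p v : A} M L₁ L₂ → s ∷ M ++ [ p ] ≡ L₁ ++ v ∷ L₂ →
    (L₁ ≡ [] × v ≡ s × L₂ ≡ M ++ [ p ]) ⊎ (L₁ ≡ s ∷ M × v ≡ p × L₂ ≡ []) ⊎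
    (∃₂ λ L₁′ L₂′ → L₁ ≡ s ∷ L₁′ × L₂ ≡ L₂′ ++ [ p ] × M ≡ L₁′ ++ v ∷ L₂′)
  ∷-∷ʳ-split M [] L₂ eq with refl , refl ← ∷-injective eq = inj₁ (refl , refl , refl)
  ∷-∷ʳ-split M (_ ∷ L₁′) L₂ eq with refl , eq′ ← ∷-injective eq | initLast L₂
  ... | [] with refl , refl ← ∷ʳ-injective M L₁′ eq′ = inj₂ (inj₁ (refl , refl , refl))
  ... | L₂′ ∷ʳ′ _ with refl , refl ← ∷ʳ-injective M (L₁′ ++ _ ∷ L₂′) (trans eq′ (sym (++-assoc L₁′ _ _))) =
    inj₂ (inj₂ (L₁′ , L₂′ , refl , refl , refl))

  Unique-++⁻ˡ : ∀ (xs : List A) {ys} → Unique (xs ++ ys) → Unique xs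
  Unique-++⁻ˡ []       _          = []
  Unique-++⁻ˡ (x ∷ xs) (x∉ ∷ uniq) = All.++⁻ˡ xs x∉ ∷ Unique-++⁻ˡ xs uniq

length-∷ʳ : ∀ {a} {A : Set a} (xs : List A) x → length (xs ++ [ x ]) ≡ suc (length xs)
length-∷ʳ xs x = trans (length-++ xs) (+-comm (length xs) 1)

length-insert : ∀ {a} {A : Set a} (xs : List A) x ys → length (xs ++ x ∷ ys) ≡ suc (length (xs ++ ys))
length-insert xs x ys = trans (length-++ xs) (trans (+-suc (length xs) _) (cong suc (sym (length-++ xs))))

Unique-resp-↭ : ∀ {xs ys : List ℕ} → xs ↭ ys → Unique xs → Unique ys
Unique-resp-↭ p = Unique-resp-↭ₛ (↭⇒↭ₛ p)

adj-sym : ∀ {E x y} → Adj E x y → Adj E y x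
adj-sym = Sum.swap

adj-⊆ : ∀ {E E′ x y} → E ⊆ E′ → Adj E x y → Adj E′ x y
adj-⊆ E⊆E′ = Sum.map E⊆E′ E⊆E′

walk-∷ʳ : ∀ {E u w v vs} → Walk E u w vs → Adj E w v → Walk E u v (vs ++ [ v ])
walk-∷ʳ (single _) adj   = cons adj (single _)
walk-∷ʳ (cons adj′ w) adj = cons adj′ (walk-∷ʳ w adj)

walk-reverse : ∀ {E u v vs} → Walk E u v vs → Walk E v u (reverse vs)
walk-reverse (single u) = single u
walk-reverse {E} (cons {vs = vs} adj w) =
  subst (Walk E _ _) (sym (unfold-reverse _ vs)) (walk-∷ʳ (walk-reverse w) (adj-sym adj))

walk-⊆ : ∀ {E E′ u v vs} → E ⊆ E′ → Walk E u v vs → Walk E′ u v vs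
walk-⊆ E⊆E′ (single u)  = single u
walk-⊆ E⊆E′ (cons adj w) = cons (adj-⊆ E⊆E′ adj) (walk-⊆ E⊆E′ w)

EdgesBelow : ℕ → Edges → Set
EdgesBelow n = All ((_< n) ⟨×⟩ (_< n))

walk-bounded : ∀ {n E u v vs} → EdgesBelow n E → Walk E u v vs → u < n → All (_< n) vs
walk-bounded bounded (single _)          u<n = u<n ∷ []
walk-bounded bounded (cons (inj₁ e) w) u<n = u<n ∷ walk-bounded bounded w (proj₂ (All.lookup bounded e))
walk-bounded bounded (cons (inj₂ e) w) u<n = u<n ∷ walk-bounded bounded w (proj₁ (All.lookup bounded e))

path-reverse : ∀ {E u v ℓ} → Path E u v ℓ → Path E v u ℓ
path-reverse (vs , w , uniq , len) =
  reverse vs , walk-reverse w , Unique-resp-↭ (↭-sym (↭-reverse vs)) uniq , trans (length-reverse vs) len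

path-⊆ : ∀ {E E′ u v ℓ} → E ⊆ E′ → Path E u v ℓ → Path E′ u v ℓ
path-⊆ E⊆E′ (vs , w , uniq , len) = vs , walk-⊆ E⊆E′ w , uniq , len

edge-path : ∀ {E u v} → Adj E u v → u ≢ v → Path E u v 1
edge-path adj u≢v = _ , cons adj (single _) , (u≢v ∷ []) ∷ [] ∷ [] , refl

path-∷-fresh : ∀ {n E E′ u v ℓ} → EdgesBelow n E → E ⊆ E′ → Adj E′ n u → u < n →
  Path E u v ℓ → Path E′ n v (suc ℓ)
path-∷-fresh {n} bounded E⊆E′ adj u<n (vs , w , uniq , len) =
  n ∷ vs , cons adj (walk-⊆ E⊆E′ w) , All.map >⇒≢ (walk-bounded bounded w u<n) ∷ uniq , cong suc len

Between : ℕ → ℕ → ℕ → Set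
Between a b ℓ = a ≤ ℓ × ℓ ≤ b ⊎ b ≤ ℓ × ℓ ≤ a

between-sym : ∀ {a b ℓ} → Between a b ℓ → Between b a ℓ
between-sym = Sum.swap

between-same : ∀ {a ℓ} → Between a a ℓ → a ≡ ℓ
between-same (inj₁ (a≤ℓ , ℓ≤a)) = ≤-antisym a≤ℓ ℓ≤a
between-same (inj₂ (a≤ℓ , ℓ≤a)) = ≤-antisym a≤ℓ ℓ≤a

between-sucʳ : ∀ {a b ℓ} → Between a (suc b) ℓ → Between a b ℓ ⊎ ℓ ≡ suc b
between-sucʳ (inj₁ (a≤ℓ , ℓ≤1+b)) with m≤n⇒m<n∨m≡n ℓ≤1+b
... | inj₁ (s≤s ℓ≤b) = inj₁ (inj₁ (a≤ℓ , ℓ≤b))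
... | inj₂ ℓ≡1+b     = inj₂ ℓ≡1+b
between-sucʳ (inj₂ (1+b≤ℓ , ℓ≤a)) = inj₁ (inj₂ (<⇒≤ 1+b≤ℓ , ℓ≤a))

between-suc⁻ : ∀ {a b ℓ} → Between (suc (suc a)) (suc b) (suc ℓ) →
  Between (suc a) (suc b) ℓ ⊎ Between (suc (suc a)) b ℓ
between-suc⁻ (inj₁ (s≤s a<ℓ , s≤s ℓ≤b)) = inj₁ (inj₁ (a<ℓ , m≤n⇒m≤1+n ℓ≤b))
between-suc⁻ (inj₂ (s≤s b≤ℓ , s≤s ℓ≤1+a)) = inj₂ (inj₂ (b≤ℓ , m≤n⇒m≤1+n ℓ≤1+a))

between-one-pred : ∀ {b ℓ} → Between 1 (suc (suc b)) (suc (suc ℓ)) → Between 1 (suc b) (suc ℓ)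
between-one-pred (inj₁ (_ , s≤s ℓ≤b)) = inj₁ (s≤s z≤n , ℓ≤b)
between-one-pred (inj₂ (_ , s≤s ()))

between-⊓ : ∀ a b {ℓ} → a ⊓ b ≤ ℓ → ℓ ≤ a + b ∸ a ⊓ b → Between a b ℓ
between-⊓ a b lo hi with ≤-total a b
... | inj₁ a≤b rewrite m≤n⇒m⊓n≡m a≤b | m+n∸m≡n a b = inj₁ (lo , hi)
... | inj₂ b≤a rewrite m≥n⇒m⊓n≡n b≤a | m+n∸n≡m a b = inj₂ (lo , hi)

-- Boundary arcs

BoundaryAdjacent : Edges → List ℕ → Set
BoundaryAdjacent E B = ∀ {x y Z} → Rotation B (x ∷ y ∷ Z) → Adj E x y

-- The two boundary arcs between x and v have suc (length L₁) and suc (length L₂) edges.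
ArcPaths : Edges → List ℕ → Set
ArcPaths E B = ∀ {x L₁ v L₂} → Rotation B (x ∷ L₁ ++ v ∷ L₂) →
  ∀ {ℓ} → Between (suc (length L₁)) (suc (length L₂)) ℓ → Path E x v ℓ

boundary-walk : ∀ {E B} → BoundaryAdjacent E B → ∀ L {x v R} → Rotation B (x ∷ L ++ v ∷ R) →
  Walk E x v (x ∷ L ++ [ v ])
boundary-walk adjacent []      r = cons (adjacent r) (single _)
boundary-walk adjacent (y ∷ L) {x} {v} {R} r =
  cons (adjacent r) (boundary-walk adjacent L (rotation-trans r r′))
  where
    r′ : Rotation (x ∷ y ∷ L ++ v ∷ R) (y ∷ L ++ v ∷ R ++ [ x ])
    r′ = [ x ] , y ∷ L ++ v ∷ R , refl , cong (y ∷_) (sym (++-assoc L (v ∷ R) [ x ]))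

boundary-path : ∀ {E B x L v R} → BoundaryAdjacent E B → Unique B → Rotation B (x ∷ L ++ v ∷ R) →
  Path E x v (suc (length L))
boundary-path {x = x} {L} {v} {R} adjacent uniq r =
  x ∷ L ++ [ v ] , boundary-walk adjacent L r ,
  Unique-++⁻ˡ (x ∷ L ++ [ v ]) (subst Unique (cong (x ∷_) (sym (++-assoc L [ v ] R)))
                                  (Unique-resp-↭ (rotation⇒↭ r) uniq)) ,
  cong suc (length-∷ʳ L v)

record BoundaryPaths (t : ℕ) (E : Edges) (B : List ℕ) : Set where
  field
    vertices          : B ↭ downFrom t
    edges-below     : EdgesBelow t E
    boundary-adjacent : BoundaryAdjacent E B
    arc-paths         : ArcPaths E B

  length-boundary : length B ≡ t
  length-boundary = trans (↭-length vertices) (length-downFrom t)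

  rotation-head< : ∀ {x R} → Rotation B (x ∷ R) → x < t
  rotation-head< r = ∈-downFrom⁻ (∈-resp-↭ vertices (∈-resp-↭ (↭-sym (rotation⇒↭ r)) (here refl)))

boundaryPaths-rotate : ∀ {t E B B′} → BoundaryPaths t E B → Rotation B B′ → BoundaryPaths t E B′
boundaryPaths-rotate I r = record
  { vertices          = ↭-trans (↭-sym (rotation⇒↭ r)) vertices
  ; edges-below     = edges-below
  ; boundary-adjacent = λ r′ → boundary-adjacent (rotation-trans r r′)
  ; arc-paths         = λ r′ → arc-paths (rotation-trans r r′)
  }
  where open BoundaryPaths I

boundaryPaths-⊆ : ∀ {t E E′ B} → BoundaryPaths t E B → E ⊆ E′ → EdgesBelow t E′ →
  BoundaryPaths t E′ B
boundaryPaths-⊆ I E⊆E′ bounded = record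
  { vertices          = vertices
  ; edges-below     = bounded
  ; boundary-adjacent = λ r → adj-⊆ E⊆E′ (boundary-adjacent r)
  ; arc-paths         = λ r b → path-⊆ E⊆E′ (arc-paths r b)
  }
  where open BoundaryPaths I

-- Inserting a vertex into a boundary edge

module InsertVertex {n E s M p} (I : BoundaryPaths n E (s ∷ M ++ [ p ])) where

  open BoundaryPaths I

  C : List ℕ
  C = s ∷ M ++ [ p ]

  E⁺ : Edges
  E⁺ = (p , n) ∷ (n , s) ∷ E

  E⊆E⁺ : E ⊆ E⁺
  E⊆E⁺ e = there (there e)

  n-s : Adj E⁺ n s
  n-s = inj₁ (there (here refl))

  n-p : Adj E⁺ n p
  n-p = inj₂ (here refl)

  s<n : s < n
  s<n = rotation-head< (rotation-refl C)

  p<n : p < n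
  p<n = rotation-head< (rotation-swap (s ∷ M) [ p ])

  vertices⁺ : n ∷ C ↭ downFrom (suc n)
  vertices⁺ = prep n vertices

  unique⁺ : Unique (n ∷ C)
  unique⁺ = Unique-resp-↭ (↭-sym vertices⁺) (downFrom⁺ (suc n))

  boundary-adjacent⁺ : BoundaryAdjacent E⁺ (n ∷ C)
  boundary-adjacent⁺ {x} {y} {Z} r with rotation-∷-split [ x ] (y ∷ Z) r
  ... | inj₁ ([] , _ , refl , eq) with refl , _ ← ∷-injective eq = n-s
  ... | inj₁ (_ ∷ [] , _ , () , _)
  ... | inj₁ (_ ∷ _ ∷ _ , _ , () , _)
  ... | inj₂ ([] , Q , refl , eq) with refl , refl ← ∷ʳ-injective (s ∷ M) Q eq = adj-sym n-p
  ... | inj₂ (_ ∷ P , Q , refl , eq) = adj-⊆ E⊆E⁺ (boundary-adjacent (Q , x ∷ y ∷ P , eq , refl))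

  via : ∀ {w L₁ v L₂ k} → Adj E⁺ n w → Rotation C (w ∷ L₁ ++ v ∷ L₂) →
    Between (suc (length L₁)) (suc (length L₂)) k → Path E⁺ n v (suc k)
  via adj r b = path-∷-fresh edges-below E⊆E⁺ adj (rotation-head< r) (arc-paths r b)

  paths-from-n-to-s : ∀ {ℓ} → Between 1 (suc (suc (length M))) ℓ → Path E⁺ n s ℓ
  paths-from-n-to-s {0}           (inj₁ (() , _))
  paths-from-n-to-s {0}           (inj₂ (() , _))
  paths-from-n-to-s {1}           _ = edge-path n-s (>⇒≢ s<n)
  paths-from-n-to-s {suc (suc k)} b = via {L₁ = []} n-p (rotation-swap (s ∷ M) [ p ]) (between-one-pred b)

  paths-from-n-to-p : ∀ {ℓ} → Between (suc (suc (length M))) 1 ℓ → Path E⁺ n p ℓ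
  paths-from-n-to-p {0}           (inj₁ (() , _))
  paths-from-n-to-p {0}           (inj₂ (() , _))
  paths-from-n-to-p {1}           _ = edge-path n-p (>⇒≢ p<n)
  paths-from-n-to-p {suc (suc k)} b =
    via n-s (rotation-refl C) (between-sym (between-one-pred (between-sym b)))

  paths-from-n-into-M : ∀ L₁ {v} L₂ {ℓ} → M ≡ L₁ ++ v ∷ L₂ →
    Between (suc (suc (length L₁))) (suc (suc (length L₂))) ℓ → Path E⁺ n v ℓ
  paths-from-n-into-M L₁ L₂ {0} refl (inj₁ (() , _))
  paths-from-n-into-M L₁ L₂ {0} refl (inj₂ (() , _))
  paths-from-n-into-M L₁ {v} L₂ {suc k} refl b with between-suc⁻ b
  ... | inj₁ b′ = via n-s (rotation-reflexive (cong (s ∷_) (++-assoc L₁ (v ∷ L₂) [ p ])))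
                      (subst (λ m → Between _ (suc m) k) (sym (length-∷ʳ L₂ p)) b′)
  ... | inj₂ b′ = via {L₁ = s ∷ L₁} n-p (rotation-swap (s ∷ M) [ p ]) b′

  paths-from-n : ∀ L₁ {v L₂ ℓ} → C ≡ L₁ ++ v ∷ L₂ →
    Between (suc (length L₁)) (suc (length L₂)) ℓ → Path E⁺ n v ℓ
  paths-from-n L₁ {L₂ = L₂} eq b with ∷-∷ʳ-split M L₁ L₂ eq
  ... | inj₁ (refl , refl , refl) =
    paths-from-n-to-s (subst (λ m → Between 1 (suc m) _) (length-∷ʳ M p) b)
  ... | inj₂ (inj₁ (refl , refl , refl)) = paths-from-n-to-p b
  ... | inj₂ (inj₂ (L₁′ , L₂′ , refl , refl , eqM)) =
    paths-from-n-into-M L₁′ L₂′ eqM (subst (λ m → Between _ (suc m) _) (length-∷ʳ L₂′ p) b)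

  -- Lengths up to that of the old arc are realised by old paths; the arc through n is
  -- one edge longer and is itself a path.
  paths-across-n : ∀ {x P Q v L₂ ℓ} → Rotation (n ∷ C) (x ∷ (P ++ n ∷ Q) ++ v ∷ L₂) →
    C ≡ Q ++ v ∷ L₂ ++ x ∷ P → Between (suc (length (P ++ n ∷ Q))) (suc (length L₂)) ℓ → Path E⁺ x v ℓ
  paths-across-n {x} {P} {Q} {v} {L₂} r eq b
    with between-sucʳ (between-sym (subst (λ m → Between (suc m) _ _) (length-insert P n Q) b))
  ... | inj₁ b′  = path-reverse (path-⊆ E⊆E⁺ (arc-paths r-old b′))
    where
      r-old : Rotation C (v ∷ L₂ ++ x ∷ (P ++ Q))
      r-old = Q , v ∷ L₂ ++ x ∷ P , eq , sym (++-assoc (v ∷ L₂) (x ∷ P) Q)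
  ... | inj₂ refl = subst (Path E⁺ x v) (cong suc (length-insert P n Q))
                      (boundary-path boundary-adjacent⁺ unique⁺ r)

  paths-on-arc-through-n : ∀ {x L₁ v L₂ P Q ℓ} → Rotation (n ∷ C) (x ∷ L₁ ++ v ∷ L₂) →
    x ∷ L₁ ≡ P ++ n ∷ Q → C ≡ Q ++ (v ∷ L₂) ++ P →
    Between (suc (length L₁)) (suc (length L₂)) ℓ → Path E⁺ x v ℓ
  paths-on-arc-through-n {v = v} {L₂} {[]} {Q} _ refl eq b =
    paths-from-n Q (trans eq (cong (λ R → Q ++ v ∷ R) (++-identityʳ L₂))) b
  paths-on-arc-through-n {P = _ ∷ _} r refl eq b = paths-across-n r eq b

  arc-paths⁺ : ArcPaths E⁺ (n ∷ C)
  arc-paths⁺ {x} {L₁} {v} {L₂} r b with rotation-∷-split (x ∷ L₁) (v ∷ L₂) r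
  ... | inj₁ (_ , _ , eqX , eq) = paths-on-arc-through-n r eqX eq b
  ... | inj₂ (_ , _ , eqV , eq) =
    path-reverse (paths-on-arc-through-n (rotation-trans r (rotation-swap (x ∷ L₁) (v ∷ L₂))) eqV eq
                                           (between-sym b))

  boundaryPaths⁺ : BoundaryPaths (suc n) E⁺ (n ∷ C)
  boundaryPaths⁺ = record
    { vertices          = vertices⁺
    ; edges-below     = (m<n⇒m<1+n p<n , n<1+n n) ∷ (n<1+n n , m<n⇒m<1+n s<n) ∷
                          All.map (Product.map m<n⇒m<1+n m<n⇒m<1+n) edges-below
    ; boundary-adjacent = boundary-adjacent⁺
    ; arc-paths         = arc-paths⁺
    }

-- Trigonal graphs

-- K₃ arises from the single edge 01, read as a boundary cycle of length two, by one
-- insertion.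
boundaryPaths-K₂ : BoundaryPaths 2 ((0 , 1) ∷ []) (0 ∷ 1 ∷ [])
boundaryPaths-K₂ = record
  { vertices          = vertices
  ; edges-below     = (z<s , s<s z<s) ∷ []
  ; boundary-adjacent = adjacent
  ; arc-paths         = arc-paths
  }
  where
    vertices : 0 ∷ 1 ∷ [] ↭ downFrom 2
    vertices = swap 0 1 ↭-refl

    adjacent : BoundaryAdjacent ((0 , 1) ∷ []) (0 ∷ 1 ∷ [])
    adjacent ([]              , _ , refl , refl) = inj₁ (here refl)
    adjacent (_ ∷ []          , _ , refl , refl) = inj₂ (here refl)
    adjacent (_ ∷ _ ∷ []      , _ , refl , refl) = inj₁ (here refl)
    adjacent (_ ∷ _ ∷ _ ∷ _ , _ , ()   , _)

    arc-paths : ArcPaths ((0 , 1) ∷ []) (0 ∷ 1 ∷ [])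
    arc-paths {L₁ = []} {L₂ = []} r b =
      subst (Path _ _ _) (between-same b) (boundary-path {L = []} adjacent (((λ ()) ∷ []) ∷ [] ∷ []) r)
    arc-paths {L₁ = []} {L₂ = _ ∷ _} r _ with ↭-length (rotation⇒↭ r)
    ... | ()
    arc-paths {L₁ = _ ∷ []} r _ with ↭-length (rotation⇒↭ r)
    ... | ()
    arc-paths {L₁ = _ ∷ _ ∷ _} r _ with ↭-length (rotation⇒↭ r)
    ... | ()

boundaryPaths-K₃ : BoundaryPaths 3 ((0 , 1) ∷ (1 , 2) ∷ (2 , 0) ∷ []) (0 ∷ 1 ∷ 2 ∷ [])
boundaryPaths-K₃ =
  boundaryPaths-rotate
    (boundaryPaths-⊆ (InsertVertex.boundaryPaths⁺ {M = []} boundaryPaths-K₂) reorder bounded)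
    (rotation-swap (2 ∷ []) (0 ∷ 1 ∷ []))
  where
    reorder : (1 , 2) ∷ (2 , 0) ∷ (0 , 1) ∷ [] ⊆ (0 , 1) ∷ (1 , 2) ∷ (2 , 0) ∷ []
    reorder (here refl)                 = there (here refl)
    reorder (there (here refl))         = there (there (here refl))
    reorder (there (there (here refl))) = here refl
    reorder (there (there (there ())))

    bounded : EdgesBelow 3 ((0 , 1) ∷ (1 , 2) ∷ (2 , 0) ∷ [])
    bounded = (z<s , s<s z<s) ∷ (s<s z<s , s<s (s<s z<s)) ∷ (s<s (s<s z<s) , z<s) ∷ []

trigonal⇒boundaryPaths : ∀ {t E B} → Trigonal t E B → BoundaryPaths t E B
trigonal⇒boundaryPaths base = boundaryPaths-K₃
trigonal⇒boundaryPaths (stepIn {n} P Q a b T) =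
  boundaryPaths-rotate
    (InsertVertex.boundaryPaths⁺ {M = Q ++ P} (boundaryPaths-rotate (trigonal⇒boundaryPaths T) old)) new
  where
    old : Rotation (P ++ a ∷ b ∷ Q) (b ∷ (Q ++ P) ++ [ a ])
    old = P ++ [ a ] , b ∷ Q , sym (++-assoc P [ a ] (b ∷ Q)) , ++-assoc (b ∷ Q) P [ a ]

    new : Rotation (n ∷ b ∷ (Q ++ P) ++ [ a ]) (P ++ a ∷ n ∷ b ∷ Q)
    new = n ∷ b ∷ Q , P ++ [ a ] , ++-assoc (n ∷ b ∷ Q) P [ a ] , sym (++-assoc P [ a ] (n ∷ b ∷ Q))
trigonal⇒boundaryPaths (stepWrap {n} P a b T) =
  boundaryPaths-rotate (InsertVertex.boundaryPaths⁺ (trigonal⇒boundaryPaths T))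
                       ([ n ] , a ∷ P ++ [ b ] , refl , sym (++-assoc (a ∷ P) [ b ] [ n ]))

lookup-split : ∀ {a} {A : Set a} (xs : List A) (j : Fin (length xs)) →
  ∃₂ λ M R → xs ≡ M ++ lookup xs j ∷ R × length M ≡ toℕ j
lookup-split (x ∷ xs) zero    = [] , xs , refl , refl
lookup-split (x ∷ xs) (suc j) with M , R , eq , len ← lookup-split xs j =
  x ∷ M , R , cong (x ∷_) eq , cong suc len

lookup-split₂ : ∀ {a} {A : Set a} (xs : List A) (i j : Fin (length xs)) → toℕ i < toℕ j →
  ∃₂ λ X M → ∃ λ R → xs ≡ X ++ lookup xs i ∷ M ++ lookup xs j ∷ R × toℕ j ≡ toℕ i + suc (length M)
lookup-split₂ (x ∷ xs) zero    (suc j) _ with M , R , eq , len ← lookup-split xs j =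
  [] , M , R , cong (x ∷_) eq , cong suc (sym len)
lookup-split₂ (x ∷ xs) (suc i) (suc j) (s≤s i<j) with X , M , R , eq , len ← lookup-split₂ xs i j i<j =
  x ∷ X , M , R , cong (x ∷_) eq , cong suc len

arc-lengths : ∀ {B : List ℕ} {u M v R} → Rotation B (u ∷ M ++ v ∷ R) →
  length B ≡ suc (length M) + suc (length R)
arc-lengths {M = M} r = trans (↭-length (rotation⇒↭ r)) (cong suc (length-++ M))

paths-within-arcs : ∀ {t E B u M v R ℓ} → BoundaryPaths t E B → Rotation B (u ∷ M ++ v ∷ R) →
  let d = suc (length M) ⊓ suc (length R) in d ≤ ℓ → ℓ ≤ t ∸ d → Path E u v ℓ
paths-within-arcs {t} {M = M} {R = R} {ℓ} I r lo hi =
  arc-paths r (between-⊓ a b lo (subst (λ m → ℓ ≤ m ∸ a ⊓ b) t≡a+b hi))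
  where
    open BoundaryPaths I
    a = suc (length M)
    b = suc (length R)

    t≡a+b : t ≡ a + b
    t≡a+b = trans (sym length-boundary) (arc-lengths r)

cycDist-comm : ∀ B i j → cycDist B i j ≡ cycDist B j i
cycDist-comm B i j = cong (λ d → d ⊓ (length B ∸ d)) (∣-∣-comm (toℕ i) (toℕ j))

paths-between-ordered-positions : ∀ {t E B} → BoundaryPaths t E B → ∀ i j → toℕ i < toℕ j → ∀ {ℓ} →
  cycDist B i j ≤ ℓ → ℓ ≤ t ∸ cycDist B i j → Path E (lookup B i) (lookup B j) ℓ
paths-between-ordered-positions {B = B} I i j i<j lo hi
  with X , M , R , eq , j≡i+a ← lookup-split₂ B i j i<j =
  paths-within-arcs I r (subst (_≤ _) d≡ lo) (subst (λ d → _ ≤ _ ∸ d) d≡ hi)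
  where
    a = suc (length M)
    b = suc (length (R ++ X))

    r : Rotation B (lookup B i ∷ M ++ lookup B j ∷ R ++ X)
    r = X , _ , eq , sym (++-assoc (lookup B i ∷ M) (lookup B j ∷ R) X)

    d≡ : cycDist B i j ≡ a ⊓ b
    d≡ = begin
      ∣ toℕ i - toℕ j ∣ ⊓ (length B ∸ ∣ toℕ i - toℕ j ∣) ≡⟨ cong (λ d → d ⊓ (length B ∸ d)) ∣i-j∣≡a ⟩
      a ⊓ (length B ∸ a)                                 ≡⟨ cong (λ m → a ⊓ (m ∸ a)) (arc-lengths r) ⟩
      a ⊓ (a + b ∸ a)                                    ≡⟨ cong (a ⊓_) (m+n∸m≡n a b) ⟩
      a ⊓ b                                              ∎
      where
        open ≡-Reasoning
        ∣i-j∣≡a : ∣ toℕ i - toℕ j ∣ ≡ a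
        ∣i-j∣≡a = trans (cong (∣ toℕ i -_∣) j≡i+a) (∣m-m+n∣≡n (toℕ i) a)

paths-between-positions : ∀ {t E B u v} → BoundaryPaths t E B → u ≢ v →
  ∀ (i j : Fin (length B)) → lookup B i ≡ u → lookup B j ≡ v →
  ∀ ℓ → cycDist B i j ≤ ℓ → ℓ ≤ t ∸ cycDist B i j → Path E u v ℓ
paths-between-positions {B = B} I u≢v i j refl refl ℓ lo hi with <-cmp (toℕ i) (toℕ j)
... | tri< i<j _ _ = paths-between-ordered-positions I i j i<j lo hi
... | tri≈ _ i≡j _ = ⊥-elim (u≢v (cong (lookup B) (toℕ-injective i≡j)))
... | tri> _ _ j<i = path-reverse (paths-between-ordered-positions I j i j<i
                       (subst (_≤ ℓ) (cycDist-comm B i j) lo)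
                       (subst (λ d → ℓ ≤ _ ∸ d) (cycDist-comm B i j) hi))

boundaryEdge⇒rotation : ∀ {B u v} → BoundaryEdge B u v →
  (∃ λ R → Rotation B (u ∷ v ∷ R)) ⊎ (∃ λ R → Rotation B (v ∷ u ∷ R))
boundaryEdge⇒rotation (inj₁ (P , Q , eq))                 = inj₁ (Q ++ P , P , _ , eq , refl)
boundaryEdge⇒rotation (inj₂ (inj₁ (P , Q , eq)))          = inj₂ (Q ++ P , P , _ , eq , refl)
boundaryEdge⇒rotation (inj₂ (inj₂ (inj₁ (P , eq))))       = inj₂ (P , _ ∷ P , _ , eq , refl)
boundaryEdge⇒rotation (inj₂ (inj₂ (inj₂ (P , eq))))       = inj₁ (P , _ ∷ P , _ , eq , refl)

paths-along-boundaryEdge : ∀ {t E B u v} → BoundaryPaths t E B → BoundaryEdge B u v →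
  ∀ ℓ → 1 ≤ ℓ → ℓ ≤ t ∸ 1 → Path E u v ℓ
paths-along-boundaryEdge I e ℓ lo hi with boundaryEdge⇒rotation e
... | inj₁ (_ , r) = paths-within-arcs {M = []} I r lo hi
... | inj₂ (_ , r) = path-reverse (paths-within-arcs {M = []} I r lo hi)

mainTheorem9 : ∀ {t : ℕ} {E : Edges} {B : List ℕ} → Trigonal t E B →
    ∀ (u v : ℕ) → u ≢ v →
    (∀ (i j : Fin (length B)) → lookup B i ≡ u → lookup B j ≡ v →
      ∀ (ℓ : ℕ) → cycDist B i j ≤ ℓ → ℓ ≤ t ∸ cycDist B i j → Path E u v ℓ)
    × (BoundaryEdge B u v → ∀ (ℓ : ℕ) → 1 ≤ ℓ → ℓ ≤ t ∸ 1 → Path E u v ℓ)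
mainTheorem9 T u v u≢v = paths-between-positions I u≢v , paths-along-boundaryEdge I
  where I = trigonal⇒boundaryPaths T
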